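{- Let $\mathbf{U}=(\mathbf{T},\exists)$ be a monadic $N_c$-algebra with center $c$. Then the map $\beta:T\to K(C(T))$, $\beta(x)=(x\vee c,\sim x\vee c)$, is an isomorphism of monadic $N_c$-algebras from $\mathbf{U}$ onto $\mathbf{K}(C(\mathbf{U}))$.
   Context: A De Morgan algebra is a bounded distributive lattice with a unary $\sim$ satisfying $\sim\sim x=x$ and $\sim(x\vee y)=\sim x\wedge\sim y$; a Kleene algebra is a De Morgan algebra with $x\wedge\sim x\leq y\vee\sim y$. A Nelson algebra is $\mathbf{T}=\langle T,\vee,\wedge,\to,\sim,0,1\rangle$ with Kleene reduct satisfying $x\to x=1$, $x\to(y\to z)=(x\wedge y)\to z$, $x\wedge(x\to y)=x\wedge(\sim x\vee y)$; prelinear if $(x\to y)\vee(y\to x)=1$; centered if there is a (unique) $c$ with $\sim c=c$. A monadic Nelson algebra is $(\mathbf{T},\exists)$ with $\mathbf{T}$ a Nelson algebra and, writing $\forall x:=\sim\exists(\sim x)$: $\exists 0=0$; $x\leq\exists x$; $\exists(x\wedge\exists y)=\exists x\wedge\exists y$; $\exists(x\vee y)=\exists x\vee\exists y$; $\forall\exists x=\exists x$; $\forall(x\to y)\leq\exists x\to\exists y$; $\forall(x\to y)\leq\forall x\to\forall y$. A monadic $N_c$-algebra is a monadic Nelson algebra with $\mathbf{T}$ prelinear and centered with center $c$ and $c\in\exists(T)$; its morphisms preserve $\vee,\wedge,\to,\sim,0,1,\exists$. $C(\mathbf{U})$ is the set $C(T)=\{x\in T:x\geq c\}$ with the restrictions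 of $\wedge,\vee,\to,\exists,\forall$, bottom $c$ and top $1$ (a monadic Gödel algebra with Heyting implication $\to$). For a monadic Gödel algebra $(\mathbf{A},\forall,\exists)$ with bottom $0_A$, top $1_A$ and implication $\Rightarrow$, $\mathbf{K}$ of it is the algebra on $K(A)=\{(a,b)\in A\times A: a\wedge b=0_A\}$ with $(a,b)\vee(d,e)=(a\vee d,b\wedge e)$, $(a,b)\wedge(d,e)=(a\wedge d,b\vee e)$, $(a,b)\to(d,e)=(a\Rightarrow d,a\wedge e)$, $\sim(a,b)=(b,a)$, $0=(0_A,1_A)$, $1=(1_A,0_A)$, center $(0_A,0_A)$, and $\exists_K(a,b)=(\exists a,\forall b)$. Applied to $C(\mathbf{U})$, this gives $\mathbf{K}(C(\mathbf{U}))$ on $K(C(T))=\{(a,b)\in C(T)^2: a\wedge b=c\}$. -}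

module Defs where

open import Level using (Level; suc)
open import Data.Product using (Σ; _×_; _,_; proj₁; proj₂)
open import Relation.Binary.PropositionalEquality using (_≡_)
open import Algebra.Lattice.Structures using (IsDistributiveLattice)

record MonadicNcAlgebra (ℓ : Level) : Set (suc ℓ) where
  infixr 6 _∨_
  infixr 7 _∧_
  infixr 5 _⇒_
  field
    Carrier : Set ℓ
    _∨_ _∧_ _⇒_ : Carrier → Carrier → Carrier
    ∼ : Carrier → Carrier
    𝟎 𝟏 : Carrier
    ∃ : Carrier → Carrier
    c : Carrier

  _≤_ : Carrier → Carrier → Set ℓ
  x ≤ y = x ∧ y ≡ x

  ∀' : Carrier → Carrier
  ∀' x = ∼ (∃ (∼ x))

  field
    isDistributiveLattice : IsDistributiveLattice _≡_ _∨_ _∧_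
    𝟎-least : ∀ x → 𝟎 ∨ x ≡ x
    𝟏-greatest : ∀ x → 𝟏 ∧ x ≡ x
    ∼-involutive : ∀ x → ∼ (∼ x) ≡ x
    ∼-deMorgan : ∀ x y → ∼ (x ∨ y) ≡ ∼ x ∧ ∼ y
    kleene : ∀ x y → (x ∧ ∼ x) ≤ (y ∨ ∼ y)
    ⇒-refl : ∀ x → x ⇒ x ≡ 𝟏
    ⇒-curry : ∀ x y z → x ⇒ (y ⇒ z) ≡ (x ∧ y) ⇒ z
    ⇒-mp : ∀ x y → x ∧ (x ⇒ y) ≡ x ∧ (∼ x ∨ y)
    prelinear : ∀ x y → (x ⇒ y) ∨ (y ⇒ x) ≡ 𝟏
    center : ∼ c ≡ c
    ∃-𝟎 : ∃ 𝟎 ≡ 𝟎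
    ∃-extensive : ∀ x → x ≤ ∃ x
    ∃-∧ : ∀ x y → ∃ (x ∧ ∃ y) ≡ ∃ x ∧ ∃ y
    ∃-∨ : ∀ x y → ∃ (x ∨ y) ≡ ∃ x ∨ ∃ y
    ∀∃ : ∀ x → ∀' (∃ x) ≡ ∃ x
    ∀⇒-∃ : ∀ x y → ∀' (x ⇒ y) ≤ (∃ x ⇒ ∃ y)
    ∀⇒-∀ : ∀ x y → ∀' (x ⇒ y) ≤ (∀' x ⇒ ∀' y)
    c∈∃T : Σ Carrier (λ y → ∃ y ≡ c)

module KC {ℓ : Level} (U : MonadicNcAlgebra ℓ) where
  open MonadicNcAlgebra U

  -- C(U): elements x ≥ c, operations are the restrictions of those of T,
  -- bottom c, top 1.  K(C(U)) is represented by pairs in T × T satisfying InKC.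
  InC : Carrier → Set ℓ
  InC x = c ≤ x

  InKC : Carrier × Carrier → Set ℓ
  InKC (a , b) = InC a × InC b × (a ∧ b ≡ c)

  _∨K_ : Carrier × Carrier → Carrier × Carrier → Carrier × Carrier
  (a , b) ∨K (d , e) = (a ∨ d , b ∧ e)

  _∧K_ : Carrier × Carrier → Carrier × Carrier → Carrier × Carrier
  (a , b) ∧K (d , e) = (a ∧ d , b ∨ e)

  _⇒K_ : Carrier × Carrier → Carrier × Carrier → Carrier × Carrier
  (a , b) ⇒K (d , e) = (a ⇒ d , a ∧ e)

  ∼K : Carrier × Carrier → Carrier × Carrier
  ∼K (a , b) = (b , a)

  𝟎K 𝟏K : Carrier × Carrier
  𝟎K = (c , 𝟏)
  𝟏K = (𝟏 , c)

  ∃K : Carrier × Carrier → Carrier × Carrier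
  ∃K (a , b) = (∃ a , ∀' b)

  β : Carrier → Carrier × Carrier
  β x = (x ∨ c , ∼ x ∨ c)

  record IsIsoOntoKC : Set ℓ where
    field
      into : ∀ x → InKC (β x)
      injective : ∀ x y → β x ≡ β y → x ≡ y
      onto : ∀ p → InKC p → Σ Carrier (λ x → β x ≡ p)
      pres-∨ : ∀ x y → β (x ∨ y) ≡ β x ∨K β y
      pres-∧ : ∀ x y → β (x ∧ y) ≡ β x ∧K β y
      pres-⇒ : ∀ x y → β (x ⇒ y) ≡ β x ⇒K β y
      pres-∼ : ∀ x → β (∼ x) ≡ ∼K (β x)
      pres-𝟎 : β 𝟎 ≡ 𝟎K
      pres-𝟏 : β 𝟏 ≡ 𝟏K
      pres-∃ : ∀ x → β (∃ x) ≡ ∃K (β x)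

-- In a distributive lattice x is determined by x ∨ c and x ∧ c = ∼ (∼ x ∨ c), so
-- β is injective, and it visibly commutes with the lattice operations and ∼. For ⇒
-- the key facts are that the Nelson quasi-order is the lattice order up to c
-- (x ⇒ y = 1 iff x ≤ y ∨ c) and that below c the implication agrees with ∼ x ∨ y.
-- Since c lies in the range of ∃, the monadic laws make ∃ commute with joining and
-- meeting with c.
module Submission where

open import Level using (Level)
open import Data.Product using (Σ; _,_; proj₁; proj₂)
open import Function using (_∘_)
open import Relation.Binary.PropositionalEquality
  using (_≡_; refl; sym; trans; cong; cong₂; module ≡-Reasoning)
open import Algebra.Lattice.Bundles using (DistributiveLattice)
open import Algebra.Lattice.Structures using (IsDistributiveLattice)
import Algebra.Lattice.Properties.Lattice as LatticeProperties
import Relation.Binary.Lattice.Bundles as Order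
import Relation.Binary.Lattice.Properties.JoinSemilattice as JoinSemilatticeProperties
import Relation.Binary.Lattice.Properties.MeetSemilattice as MeetSemilatticeProperties
import Relation.Binary.Reasoning.PartialOrder as PartialOrderReasoning
open import Relation.Binary.Bundles using (Poset)
open import Defs

module NcAlgebraProperties {ℓ : Level} (U : MonadicNcAlgebra ℓ) where
  open MonadicNcAlgebra U hiding (_≤_)
  open IsDistributiveLattice isDistributiveLattice
    using (∨-comm; ∨-assoc; ∧-comm; ∧-assoc; ∧-absorbs-∨;
           ∧-distribˡ-∨; ∧-distribʳ-∨; ∨-distribʳ-∧)

  distributiveLattice : DistributiveLattice ℓ ℓ
  distributiveLattice = record { isDistributiveLattice = isDistributiveLattice }

  open LatticeProperties (DistributiveLattice.lattice distributiveLattice)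
    using (∧-idem; ∨-idem; ∨-∧-orderTheoreticLattice)

  -- The order used here is the standard library's x ≤ y ⇔ x ≡ x ∧ y; the
  -- order of MonadicNcAlgebra is the symmetric x ∧ y ≡ x, so `sym` converts them.
  open Order.Lattice ∨-∧-orderTheoreticLattice
    using (_≤_; poset; joinSemilattice; meetSemilattice;
           x≤x∨y; y≤x∨y; ∨-least; x∧y≤x; x∧y≤y; ∧-greatest)
  open Poset poset
    using () renaming (refl to ≤-refl; trans to ≤-trans;
                       antisym to ≤-antisym; reflexive to ≤-reflexive)
  open JoinSemilatticeProperties joinSemilattice using (∨-monotonic; x≤y⇒x∨y≈y)
  open MeetSemilatticeProperties meetSemilattice using (∧-monotonic; y≤x⇒x∧y≈y)
  module ≤-Reasoning = PartialOrderReasoning poset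

  ≤𝟏 : ∀ x → x ≤ 𝟏
  ≤𝟏 x = sym (trans (∧-comm x 𝟏) (𝟏-greatest x))

  𝟎≤ : ∀ x → 𝟎 ≤ x
  𝟎≤ x = sym (trans (cong (𝟎 ∧_) (sym (𝟎-least x))) (∧-absorbs-∨ 𝟎 x))

  ∨-∧-cancel : ∀ {x y} z → x ∨ z ≡ y ∨ z → x ∧ z ≡ y ∧ z → x ≡ y
  ∨-∧-cancel {x} {y} z x∨z≡y∨z x∧z≡y∧z = begin
    x                  ≡⟨ sym (∧-absorbs-∨ x z) ⟩
    x ∧ (x ∨ z)        ≡⟨ cong (x ∧_) x∨z≡y∨z ⟩
    x ∧ (y ∨ z)        ≡⟨ ∧-distribˡ-∨ x y z ⟩
    (x ∧ y) ∨ (x ∧ z)  ≡⟨ cong₂ _∨_ (∧-comm x y) x∧z≡y∧z ⟩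
    (y ∧ x) ∨ (y ∧ z)  ≡⟨ ∧-distribˡ-∨ y x z ⟨
    y ∧ (x ∨ z)        ≡⟨ cong (y ∧_) x∨z≡y∨z ⟩
    y ∧ (y ∨ z)        ≡⟨ ∧-absorbs-∨ y z ⟩
    y                  ∎
    where open ≡-Reasoning

  ∧-cong-∨ : ∀ {a b} p q → a ∧ p ≡ b ∧ p → a ∧ q ≡ b ∧ q → a ∧ (p ∨ q) ≡ b ∧ (p ∨ q)
  ∧-cong-∨ {a} {b} p q ap≡bp aq≡bq = begin
    a ∧ (p ∨ q)        ≡⟨ ∧-distribˡ-∨ a p q ⟩
    (a ∧ p) ∨ (a ∧ q)  ≡⟨ cong₂ _∨_ ap≡bp aq≡bq ⟩
    (b ∧ p) ∨ (b ∧ q)  ≡⟨ ∧-distribˡ-∨ b p q ⟨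
    b ∧ (p ∨ q)        ∎
    where open ≡-Reasoning

  ∨-distribʳ-∨ : ∀ x y z → (x ∨ y) ∨ z ≡ (x ∨ z) ∨ (y ∨ z)
  ∨-distribʳ-∨ x y z = begin
    (x ∨ y) ∨ z        ≡⟨ ∨-assoc x y z ⟩
    x ∨ (y ∨ z)        ≡⟨ cong (λ t → x ∨ (y ∨ t)) (∨-idem z) ⟨
    x ∨ (y ∨ (z ∨ z))  ≡⟨ cong (x ∨_) (trans (sym (∨-assoc y z z)) (∨-comm (y ∨ z) z)) ⟩
    x ∨ (z ∨ (y ∨ z))  ≡⟨ ∨-assoc x z (y ∨ z) ⟨
    (x ∨ z) ∨ (y ∨ z)  ∎
    where open ≡-Reasoning

  ∼-∧ : ∀ x y → ∼ (x ∧ y) ≡ ∼ x ∨ ∼ y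
  ∼-∧ x y = begin
    ∼ (x ∧ y)              ≡⟨ cong ∼ (cong₂ _∧_ (∼-involutive x) (∼-involutive y)) ⟨
    ∼ (∼ (∼ x) ∧ ∼ (∼ y))  ≡⟨ cong ∼ (∼-deMorgan (∼ x) (∼ y)) ⟨
    ∼ (∼ (∼ x ∨ ∼ y))      ≡⟨ ∼-involutive (∼ x ∨ ∼ y) ⟩
    ∼ x ∨ ∼ y              ∎
    where open ≡-Reasoning

  ∼-antitone : ∀ {x y} → x ≤ y → ∼ y ≤ ∼ x
  ∼-antitone {x} {y} x≤y = begin
    ∼ y        ≡⟨ cong ∼ (x≤y⇒x∨y≈y x≤y) ⟨
    ∼ (x ∨ y)  ≡⟨ ∼-deMorgan x y ⟩
    ∼ x ∧ ∼ y  ≤⟨ x∧y≤x (∼ x) (∼ y) ⟩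
    ∼ x        ∎
    where open ≤-Reasoning

  ∼𝟏≡𝟎 : ∼ 𝟏 ≡ 𝟎
  ∼𝟏≡𝟎 = ≤-antisym (≤-trans (∼-antitone (≤𝟏 (∼ 𝟎))) (≤-reflexive (∼-involutive 𝟎))) (𝟎≤ (∼ 𝟏))

  ∼𝟎≡𝟏 : ∼ 𝟎 ≡ 𝟏
  ∼𝟎≡𝟏 = trans (cong ∼ (sym ∼𝟏≡𝟎)) (∼-involutive 𝟏)

  ∧∼≤c : ∀ x → x ∧ ∼ x ≤ c
  ∧∼≤c x = ≤-trans (sym (kleene x c)) (≤-reflexive (trans (cong (c ∨_) center) (∨-idem c)))

  c≤∨∼ : ∀ x → c ≤ x ∨ ∼ x
  c≤∨∼ x = ≤-trans (≤-reflexive (sym (trans (cong (c ∧_) center) (∧-idem c)))) (sym (kleene c x))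

  c-split : ∀ x → c ≡ (x ∧ c) ∨ (∼ x ∧ c)
  c-split x = trans (c≤∨∼ x) (trans (∧-comm c (x ∨ ∼ x)) (∧-distribʳ-∨ c x (∼ x)))

  ∼-∨c : ∀ x → ∼ (x ∨ c) ≡ ∼ x ∧ c
  ∼-∨c x = trans (∼-deMorgan x c) (cong (∼ x ∧_) center)

  ∼-∧c : ∀ x → ∼ (x ∧ c) ≡ ∼ x ∨ c
  ∼-∧c x = trans (∼-∧ x c) (cong (∼ x ∨_) center)

  ∼-∼∨c : ∀ x → ∼ (∼ x ∨ c) ≡ x ∧ c
  ∼-∼∨c x = trans (∼-∨c (∼ x)) (cong (_∧ c) (∼-involutive x))

  ⇒-𝟏 : ∀ x → x ⇒ 𝟏 ≡ 𝟏
  ⇒-𝟏 x = begin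
    x ⇒ 𝟏        ≡⟨ cong (x ⇒_) (⇒-refl x) ⟨
    x ⇒ (x ⇒ x)  ≡⟨ ⇒-curry x x x ⟩
    (x ∧ x) ⇒ x  ≡⟨ cong (_⇒ x) (∧-idem x) ⟩
    x ⇒ x        ≡⟨ ⇒-refl x ⟩
    𝟏            ∎
    where open ≡-Reasoning

  ≤⇒⇒≡𝟏 : ∀ {x y} → x ≤ y → x ⇒ y ≡ 𝟏
  ≤⇒⇒≡𝟏 {x} {y} x≤y = begin
    x ⇒ y        ≡⟨ cong (_⇒ y) x≤y ⟩
    (x ∧ y) ⇒ y  ≡⟨ ⇒-curry x y y ⟨
    x ⇒ (y ⇒ y)  ≡⟨ cong (x ⇒_) (⇒-refl y) ⟩
    x ⇒ 𝟏        ≡⟨ ⇒-𝟏 x ⟩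
    𝟏            ∎
    where open ≡-Reasoning

  ⇒⇒-absorb : ∀ {x z} y → x ≤ z → z ⇒ (x ⇒ y) ≡ x ⇒ y
  ⇒⇒-absorb {x} {z} y x≤z =
    trans (⇒-curry z x y) (cong (_⇒ y) (trans (∧-comm z x) (sym x≤z)))

  ≤∼∨⇒⇒≡𝟏 : ∀ {x y} → x ≤ ∼ x ∨ y → x ⇒ y ≡ 𝟏
  ≤∼∨⇒⇒≡𝟏 {x} {y} x≤∼x∨y =
    trans (sym (⇒⇒-absorb y (≤-refl {x}))) (≤⇒⇒≡𝟏 x≤x⇒y)
    where
    x≤x⇒y : x ≤ x ⇒ y
    x≤x⇒y = trans x≤∼x∨y (sym (⇒-mp x y))

  ∧⇒≤∨c : ∀ x y → x ∧ (x ⇒ y) ≤ y ∨ c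
  ∧⇒≤∨c x y = begin
    x ∧ (x ⇒ y)         ≡⟨ ⇒-mp x y ⟩
    x ∧ (∼ x ∨ y)       ≡⟨ ∧-distribˡ-∨ x (∼ x) y ⟩
    (x ∧ ∼ x) ∨ (x ∧ y) ≤⟨ ∨-monotonic (∧∼≤c x) (x∧y≤y x y) ⟩
    c ∨ y               ≡⟨ ∨-comm c y ⟩
    y ∨ c               ∎
    where open ≤-Reasoning

  ⇒≡𝟏⇒≤∨c : ∀ {x y} → x ⇒ y ≡ 𝟏 → x ≤ y ∨ c
  ⇒≡𝟏⇒≤∨c {x} {y} x⇒y≡𝟏 = begin
    x            ≡⟨ ≤𝟏 x ⟩
    x ∧ 𝟏        ≡⟨ cong (x ∧_) x⇒y≡𝟏 ⟨
    x ∧ (x ⇒ y)  ≤⟨ ∧⇒≤∨c x y ⟩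
    y ∨ c        ∎
    where open ≤-Reasoning

  ≤∨c⇒⇒≡𝟏 : ∀ {x y} → x ≤ y ∨ c → x ⇒ y ≡ 𝟏
  ≤∨c⇒⇒≡𝟏 {x} {y} x≤y∨c =
    ≤∼∨⇒⇒≡𝟏 (≤-trans x≤y∨c (∨-least (y≤x∨y (∼ x) y) c≤∼x∨y))
    where
    open ≤-Reasoning
    c≤∼x∨y : c ≤ ∼ x ∨ y
    c≤∼x∨y = begin
      c                    ≡⟨ c-split y ⟩
      (y ∧ c) ∨ (∼ y ∧ c)  ≡⟨ cong ((y ∧ c) ∨_) (∼-∨c y) ⟨
      (y ∧ c) ∨ ∼ (y ∨ c)  ≤⟨ ∨-monotonic (x∧y≤x y c) (∼-antitone x≤y∨c) ⟩
      y ∨ ∼ x              ≡⟨ ∨-comm y (∼ x) ⟩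
      ∼ x ∨ y              ∎

  ∧∼≤⇒ : ∀ {x z} y → x ≤ z → z ∧ ∼ z ≤ x ⇒ y
  ∧∼≤⇒ {x} {z} y x≤z = begin
    z ∧ ∼ z              ≤⟨ ∧-monotonic (≤-refl {z}) (x≤x∨y (∼ z) (x ⇒ y)) ⟩
    z ∧ (∼ z ∨ (x ⇒ y))  ≡⟨ ⇒-mp z (x ⇒ y) ⟨
    z ∧ (z ⇒ (x ⇒ y))    ≡⟨ cong (z ∧_) (⇒⇒-absorb y x≤z) ⟩
    z ∧ (x ⇒ y)          ≤⟨ x∧y≤y z (x ⇒ y) ⟩
    x ⇒ y                ∎
    where open ≤-Reasoning

  ∼∧c≤⇒ : ∀ x y → ∼ x ∧ c ≤ x ⇒ y
  ∼∧c≤⇒ x y = begin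
    ∼ x ∧ c                ≤⟨ ∧-greatest (≤-trans (x∧y≤y (∼ x) c) (y≤x∨y x c)) ≤-refl ⟩
    (x ∨ c) ∧ (∼ x ∧ c)    ≡⟨ cong ((x ∨ c) ∧_) (∼-∨c x) ⟨
    (x ∨ c) ∧ ∼ (x ∨ c)    ≤⟨ ∧∼≤⇒ y (x≤x∨y x c) ⟩
    x ⇒ y                  ∎
    where open ≤-Reasoning

  ⇒-∧c : ∀ x y → (x ⇒ y) ∧ c ≡ (∼ x ∨ y) ∧ c
  ⇒-∧c x y = begin
    (x ⇒ y) ∧ c                          ≡⟨ cong ((x ⇒ y) ∧_) (c-split x) ⟩
    (x ⇒ y) ∧ ((x ∧ c) ∨ (∼ x ∧ c))      ≡⟨ ∧-cong-∨ (x ∧ c) (∼ x ∧ c) on-x on-∼x ⟩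
    (∼ x ∨ y) ∧ ((x ∧ c) ∨ (∼ x ∧ c))    ≡⟨ cong ((∼ x ∨ y) ∧_) (c-split x) ⟨
    (∼ x ∨ y) ∧ c                        ∎
    where
    open ≡-Reasoning
    on-x : (x ⇒ y) ∧ (x ∧ c) ≡ (∼ x ∨ y) ∧ (x ∧ c)
    on-x = begin
      (x ⇒ y) ∧ (x ∧ c)      ≡⟨ ∧-assoc (x ⇒ y) x c ⟨
      ((x ⇒ y) ∧ x) ∧ c      ≡⟨ cong (_∧ c) (∧-comm (x ⇒ y) x) ⟩
      (x ∧ (x ⇒ y)) ∧ c      ≡⟨ cong (_∧ c) (⇒-mp x y) ⟩
      (x ∧ (∼ x ∨ y)) ∧ c    ≡⟨ cong (_∧ c) (∧-comm x (∼ x ∨ y)) ⟩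
      ((∼ x ∨ y) ∧ x) ∧ c    ≡⟨ ∧-assoc (∼ x ∨ y) x c ⟩
      (∼ x ∨ y) ∧ (x ∧ c)    ∎
    on-∼x : (x ⇒ y) ∧ (∼ x ∧ c) ≡ (∼ x ∨ y) ∧ (∼ x ∧ c)
    on-∼x = trans (y≤x⇒x∧y≈y (∼∧c≤⇒ x y))
              (sym (y≤x⇒x∧y≈y (≤-trans (x∧y≤x (∼ x) c) (x≤x∨y (∼ x) y))))

  c≤⇒ : ∀ {y} x → c ≤ y → c ≤ x ⇒ y
  c≤⇒ {y} x c≤y = begin
    c              ≡⟨ y≤x⇒x∧y≈y (≤-trans c≤y (y≤x∨y (∼ x) y)) ⟨
    (∼ x ∨ y) ∧ c  ≡⟨ ⇒-∧c x y ⟨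
    (x ⇒ y) ∧ c    ≤⟨ x∧y≤x (x ⇒ y) c ⟩
    x ⇒ y          ∎
    where open ≤-Reasoning

  ⇒-∨c : ∀ x y → (x ⇒ y) ∨ c ≡ (x ∨ c) ⇒ (y ∨ c)
  ⇒-∨c x y = ≤-antisym L≤R R≤L
    where
    open ≤-Reasoning
    L = (x ⇒ y) ∨ c
    R = (x ∨ c) ⇒ (y ∨ c)
    ∨c∨c≤∨c : (y ∨ c) ∨ c ≤ y ∨ c
    ∨c∨c≤∨c = ∨-least ≤-refl (y≤x∨y y c)
    L∧[x∨c]≤ : L ∧ (x ∨ c) ≤ (y ∨ c) ∨ c
    L∧[x∨c]≤ = begin
      L ∧ (x ∨ c)          ≡⟨ ∨-distribʳ-∧ c (x ⇒ y) x ⟨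
      ((x ⇒ y) ∧ x) ∨ c    ≤⟨ ∨-least (≤-trans (≤-reflexive (∧-comm (x ⇒ y) x)) (∧⇒≤∨c x y))
                                      (y≤x∨y y c) ⟩
      y ∨ c                ≤⟨ x≤x∨y (y ∨ c) c ⟩
      (y ∨ c) ∨ c          ∎
    R∧x≤ : R ∧ x ≤ y ∨ c
    R∧x≤ = begin
      R ∧ x              ≤⟨ ∧-monotonic (≤-refl {R}) (x≤x∨y x c) ⟩
      R ∧ (x ∨ c)        ≡⟨ ∧-comm R (x ∨ c) ⟩
      (x ∨ c) ∧ R        ≤⟨ ∧⇒≤∨c (x ∨ c) (y ∨ c) ⟩
      (y ∨ c) ∨ c        ≤⟨ ∨c∨c≤∨c ⟩
      y ∨ c              ∎
    L≤R : L ≤ R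
    L≤R = begin
      L      ≤⟨ ⇒≡𝟏⇒≤∨c (trans (⇒-curry L (x ∨ c) (y ∨ c)) (≤∨c⇒⇒≡𝟏 L∧[x∨c]≤)) ⟩
      R ∨ c  ≡⟨ ∨-comm R c ⟩
      c ∨ R  ≡⟨ x≤y⇒x∨y≈y (c≤⇒ (x ∨ c) (y≤x∨y y c)) ⟩
      R      ∎
    R≤L : R ≤ L
    R≤L = ⇒≡𝟏⇒≤∨c (trans (⇒-curry R x y) (≤∨c⇒⇒≡𝟏 R∧x≤))

  ∼⇒∨c : ∀ x y → ∼ (x ⇒ y) ∨ c ≡ (x ∨ c) ∧ (∼ y ∨ c)
  ∼⇒∨c x y = begin
    ∼ (x ⇒ y) ∨ c            ≡⟨ ∼-∧c (x ⇒ y) ⟨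
    ∼ ((x ⇒ y) ∧ c)          ≡⟨ cong ∼ (⇒-∧c x y) ⟩
    ∼ ((∼ x ∨ y) ∧ c)        ≡⟨ ∼-∧c (∼ x ∨ y) ⟩
    ∼ (∼ x ∨ y) ∨ c          ≡⟨ cong (_∨ c) (∼-deMorgan (∼ x) y) ⟩
    (∼ (∼ x) ∧ ∼ y) ∨ c      ≡⟨ cong (λ t → (t ∧ ∼ y) ∨ c) (∼-involutive x) ⟩
    (x ∧ ∼ y) ∨ c            ≡⟨ ∨-distribʳ-∧ c x (∼ y) ⟩
    (x ∨ c) ∧ (∼ y ∨ c)      ∎
    where open ≡-Reasoning

  ∃𝟏 : ∃ 𝟏 ≡ 𝟏
  ∃𝟏 = trans (sym (𝟏-greatest (∃ 𝟏))) (∃-extensive 𝟏)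

  ∃-∧c : ∀ x → ∃ (x ∧ c) ≡ ∃ x ∧ c
  ∃-∧c x with c∈∃T
  ... | y , ∃y≡c = begin
    ∃ (x ∧ c)    ≡⟨ cong (λ t → ∃ (x ∧ t)) ∃y≡c ⟨
    ∃ (x ∧ ∃ y)  ≡⟨ ∃-∧ x y ⟩
    ∃ x ∧ ∃ y    ≡⟨ cong (∃ x ∧_) ∃y≡c ⟩
    ∃ x ∧ c      ∎
    where open ≡-Reasoning

  ∃c : ∃ c ≡ c
  ∃c = begin
    ∃ c        ≡⟨ cong ∃ (𝟏-greatest c) ⟨
    ∃ (𝟏 ∧ c)  ≡⟨ ∃-∧c 𝟏 ⟩
    ∃ 𝟏 ∧ c    ≡⟨ cong (_∧ c) ∃𝟏 ⟩
    𝟏 ∧ c      ≡⟨ 𝟏-greatest c ⟩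
    c          ∎
    where open ≡-Reasoning

  ∃-∨c : ∀ x → ∃ (x ∨ c) ≡ ∃ x ∨ c
  ∃-∨c x = trans (∃-∨ x c) (cong (∃ x ∨_) ∃c)

  ∀-∼∨c : ∀ x → ∀' (∼ x ∨ c) ≡ ∼ (∃ x) ∨ c
  ∀-∼∨c x = begin
    ∼ (∃ (∼ (∼ x ∨ c)))  ≡⟨ cong (λ t → ∼ (∃ t)) (∼-∼∨c x) ⟩
    ∼ (∃ (x ∧ c))        ≡⟨ cong ∼ (∃-∧c x) ⟩
    ∼ (∃ x ∧ c)          ≡⟨ ∼-∧c (∃ x) ⟩
    ∼ (∃ x) ∨ c          ∎
    where open ≡-Reasoning

  open KC U

  β-into : ∀ x → InKC (β x)
  β-into x = sym (y≤x∨y x c) , sym (y≤x∨y (∼ x) c) ,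
             trans (sym (∨-distribʳ-∧ c x (∼ x))) (x≤y⇒x∨y≈y (∧∼≤c x))

  β-injective : ∀ x y → β x ≡ β y → x ≡ y
  β-injective x y βx≡βy = ∨-∧-cancel c (cong proj₁ βx≡βy) x∧c≡y∧c
    where
    x∧c≡y∧c : x ∧ c ≡ y ∧ c
    x∧c≡y∧c = trans (sym (∼-∼∨c x)) (trans (cong (∼ ∘ proj₂) βx≡βy) (∼-∼∨c y))

  -- a ∧ b = c gives a ≤ (b ⇒ ∼ b) ∨ c, and (b ⇒ ∼ b) ∧ c = ∼ b ∧ c by ⇒-∧c.
  β-onto : ∀ p → InKC p → Σ Carrier (λ x → β x ≡ p)
  β-onto (a , b) (c∧a≡c , c∧b≡c , a∧b≡c) = a ∧ t , cong₂ _,_ x∨c≡a ∼x∨c≡b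
    where
    t = b ⇒ ∼ b
    ∼b≤c : ∼ b ≤ c
    ∼b≤c = ≤-trans (∼-antitone (sym c∧b≡c)) (≤-reflexive center)
    a∨c≡a : a ∨ c ≡ a
    a∨c≡a = trans (∨-comm a c) (x≤y⇒x∨y≈y (sym c∧a≡c))
    a≤t∨c : a ≤ t ∨ c
    a≤t∨c = ⇒≡𝟏⇒≤∨c (begin
      a ⇒ t          ≡⟨ ⇒-curry a b (∼ b) ⟩
      (a ∧ b) ⇒ ∼ b  ≡⟨ cong (_⇒ ∼ b) a∧b≡c ⟩
      c ⇒ ∼ b        ≡⟨ ≤∨c⇒⇒≡𝟏 (y≤x∨y (∼ b) c) ⟩
      𝟏              ∎)
      where open ≡-Reasoning
    x∨c≡a : (a ∧ t) ∨ c ≡ a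
    x∨c≡a = begin
      (a ∧ t) ∨ c        ≡⟨ ∨-distribʳ-∧ c a t ⟩
      (a ∨ c) ∧ (t ∨ c)  ≡⟨ cong (_∧ (t ∨ c)) a∨c≡a ⟩
      a ∧ (t ∨ c)        ≡⟨ a≤t∨c ⟨
      a                  ∎
      where open ≡-Reasoning
    x∧c≡∼b : (a ∧ t) ∧ c ≡ ∼ b
    x∧c≡∼b = begin
      (a ∧ t) ∧ c              ≡⟨ ∧-assoc a t c ⟩
      a ∧ (t ∧ c)              ≡⟨ cong (a ∧_) (⇒-∧c b (∼ b)) ⟩
      a ∧ ((∼ b ∨ ∼ b) ∧ c)    ≡⟨ cong (λ s → a ∧ (s ∧ c)) (∨-idem (∼ b)) ⟩
      a ∧ (∼ b ∧ c)            ≡⟨ cong (a ∧_) ∼b≤c ⟨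
      a ∧ ∼ b                  ≡⟨ y≤x⇒x∧y≈y (≤-trans ∼b≤c (sym c∧a≡c)) ⟩
      ∼ b                      ∎
      where open ≡-Reasoning
    ∼x∨c≡b : ∼ (a ∧ t) ∨ c ≡ b
    ∼x∨c≡b = trans (sym (∼-∧c (a ∧ t))) (trans (cong ∼ x∧c≡∼b) (∼-involutive b))

  β-∨ : ∀ x y → β (x ∨ y) ≡ β x ∨K β y
  β-∨ x y = cong₂ _,_ (∨-distribʳ-∨ x y c)
    (trans (cong (_∨ c) (∼-deMorgan x y)) (∨-distribʳ-∧ c (∼ x) (∼ y)))

  β-∧ : ∀ x y → β (x ∧ y) ≡ β x ∧K β y
  β-∧ x y = cong₂ _,_ (∨-distribʳ-∧ c x y)
    (trans (cong (_∨ c) (∼-∧ x y)) (∨-distribʳ-∨ (∼ x) (∼ y) c))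

  β-⇒ : ∀ x y → β (x ⇒ y) ≡ β x ⇒K β y
  β-⇒ x y = cong₂ _,_ (⇒-∨c x y) (∼⇒∨c x y)

  β-∼ : ∀ x → β (∼ x) ≡ ∼K (β x)
  β-∼ x = cong₂ _,_ refl (cong (_∨ c) (∼-involutive x))

  β-𝟎 : β 𝟎 ≡ 𝟎K
  β-𝟎 = cong₂ _,_ (𝟎-least c)
    (trans (cong (_∨ c) ∼𝟎≡𝟏) (trans (∨-comm 𝟏 c) (x≤y⇒x∨y≈y (≤𝟏 c))))

  β-𝟏 : β 𝟏 ≡ 𝟏K
  β-𝟏 = cong₂ _,_ (trans (∨-comm 𝟏 c) (x≤y⇒x∨y≈y (≤𝟏 c)))
    (trans (cong (_∨ c) ∼𝟏≡𝟎) (𝟎-least c))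

  β-∃ : ∀ x → β (∃ x) ≡ ∃K (β x)
  β-∃ x = cong₂ _,_ (sym (∃-∨c x)) (sym (∀-∼∨c x))

lemma9 : {ℓ : Level} (U : MonadicNcAlgebra ℓ) → KC.IsIsoOntoKC U
lemma9 U = record
  { into = β-into ; injective = β-injective ; onto = β-onto
  ; pres-∨ = β-∨ ; pres-∧ = β-∧ ; pres-⇒ = β-⇒ ; pres-∼ = β-∼
  ; pres-𝟎 = β-𝟎 ; pres-𝟏 = β-𝟏 ; pres-∃ = β-∃
  }
  where open NcAlgebraProperties U
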